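{- Let $\ell\ge1$ be an integer. For $n\ge0$, let $\overline{\rho}_\ell(n)$ denote the number of partitions of $n$ in which the largest part $\lambda$ (not overlined) appears exactly once and the remaining parts form an $\ell$-regular overpartition of $\lambda$. Then, as formal power series (equivalently for $|q|<1$), $$\sum_{n=0}^{\infty}\overline{\rho}_\ell(n)q^n=\frac{(q^{2\ell};q^{2\ell})_\infty^2(q^4;q^4)_\infty}{(q^2;q^2)_\infty^2(q^{4\ell};q^{4\ell})_\infty}-\frac{2}{1-q^2}+\frac{2q^{2\ell}}{1-q^{2\ell}}+1.$$
   Context: For $|q|<1$, $(a;q)_\infty=\prod_{k=0}^{\infty}(1-aq^k)$. An overpartition of $m$ is a partition of $m$ in which the first occurrence of each part size may be overlined; it is $\ell$-regular if none of its parts is divisible by $\ell$. Since the largest part $\lambda$ appears exactly once, all remaining parts have size strictly less than $\lambda$, and $n=2\lambda$. The empty partition has no largest part, so the count is $0$ at $n=0$. -}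

module Defs where

open import Data.Nat using (ℕ; zero; suc; _+_; _*_; _∸_; _≤_; _<_; _≟_)
open import Data.Nat.Divisibility using (_∣_; _∣?_)
open import Data.Integer as ℤ using (ℤ; +_; 0ℤ; 1ℤ; -_)
open import Data.Bool using (Bool; true; false)
open import Data.Product using (Σ; _×_; _,_; proj₁)
open import Data.List using (List; []; _∷_; length; map)
open import Data.Nat.ListAction using (sum)
open import Data.List.Relation.Unary.All using (All)
open import Data.List.Relation.Unary.Linked using (Linked)
open import Data.List.Relation.Unary.Unique.Propositional using (Unique)
open import Data.List.Membership.Propositional using (_∈_)
open import Data.Sum using (_⊎_)
open import Data.Empty using (⊥)
open import Relation.Nullary using (¬_; yes; no)
open import Relation.Binary.PropositionalEquality using (_≡_)
open import Function.Bundles using (_⇔_)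

-- A part of an overpartition: its size and whether it is overlined.
Part : Set
Part = ℕ × Bool

size : Part → ℕ
size = proj₁

-- An (over)partition is a list of parts in canonical order: sizes are
-- non-increasing, and within a block of equal sizes only the first
-- occurrence may be overlined.
Step : Part → Part → Set
Step (a , _) (c , o) = c < a ⊎ (c ≡ a × o ≡ false)

IsOverpartitionOf : ℕ → List Part → Set
IsOverpartitionOf m xs =
  Linked Step xs × All (λ p → 1 ≤ size p) xs × sum (map size xs) ≡ m

IsRegular : ℕ → List Part → Set
IsRegular ℓ xs = All (λ p → ¬ (ℓ ∣ size p)) xs

RhoObj : ℕ → ℕ → List Part → Set
RhoObj ℓ n [] = ⊥
RhoObj ℓ n ((lam , o) ∷ rest) =
  o ≡ false × 1 ≤ lam × All (λ p → size p < lam) rest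
  × IsOverpartitionOf lam rest × IsRegular ℓ rest
  × lam + sum (map size rest) ≡ n

CountIs : {A : Set} → (A → Set) → ℕ → Set
CountIs {A} P k =
  Σ (List A) λ xs → Unique xs × (∀ x → (x ∈ xs) ⇔ P x) × length xs ≡ k

Series : Set
Series = ℕ → ℤ

sumTo : (ℕ → ℤ) → ℕ → ℤ
sumTo f zero = f zero
sumTo f (suc n) = sumTo f n ℤ.+ f (suc n)

_⊛_ : Series → Series → Series
(f ⊛ g) n = sumTo (λ i → f i ℤ.* g (n ∸ i)) n
infixl 7 _⊛_

_⊕_ : Series → Series → Series
(f ⊕ g) n = f n ℤ.+ g n
infixl 6 _⊕_

_⊝_ : Series → Series → Series
(f ⊝ g) n = f n ℤ.- g n
infixl 6 _⊝_

scale : ℤ → Series → Series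
scale c f n = c ℤ.* f n

mono : ℕ → Series
mono a n with n ≟ a
... | yes _ = 1ℤ
... | no _ = 0ℤ

one : Series
one = mono 0

oneMinus : ℕ → Series
oneMinus a = one ⊝ mono a

-- 1 / (1 - q^a) = Σ_k q^{ak}   (used with a ≥ 1)
geom : ℕ → Series
geom a n with a ∣? n
... | yes _ = 1ℤ
... | no _ = 0ℤ

prodTo : (ℕ → Series) → ℕ → Series
prodTo F zero = one
prodTo F (suc N) = prodTo F N ⊛ F (suc N)

-- (q^a;q^a)_∞ = ∏_{k≥1} (1 - q^{ak}), for a ≥ 1.  The coefficient of q^n
-- only depends on the factors with k ≤ n, so it is that of the product
-- of the first n factors.
poch : ℕ → Series
poch a n = prodTo (λ k → oneMinus (a * k)) n n

-- 1/(q^a;q^a)_∞ = ∏_{k≥1} 1/(1 - q^{ak}), for a ≥ 1 (same truncation).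
invPoch : ℕ → Series
invPoch a n = prodTo (λ k → geom (a * k)) n n

rhs : ℕ → Series
rhs ℓ =
  poch (2 * ℓ) ⊛ poch (2 * ℓ) ⊛ poch 4 ⊛ invPoch 2 ⊛ invPoch 2 ⊛ invPoch (4 * ℓ)
  ⊝ scale (+ 2) (geom 2)
  ⊕ scale (+ 2) (mono (2 * ℓ) ⊛ geom (2 * ℓ))
  ⊕ one

-- Since the largest part λ of a counted partition is the sum of the remaining parts, n = 2λ and
-- ρ̄_ℓ(2λ) counts the ℓ-regular overpartitions of λ all of whose parts are smaller than λ.
-- With q² replaced by q, the eta quotient factors as
--   ∏_{k ≥ 1} (1 + q^k)/(1 - q^k) · (1 - q^{ℓk})²/(1 - q^{2ℓk})  =  ∏_{ℓ ∤ k} (1 + q^k)/(1 - q^k),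
-- the generating function of ℓ-regular overpartitions.  Of the ℓ-regular overpartitions of λ ≥ 1,
-- the ones using the part λ are λ and its overlined copy, present exactly when ℓ ∤ λ: this is the
-- correction -2/(1 - q) + 2q^ℓ/(1 - q^ℓ), and the final +1 cancels the constant term.
-- Infinite products are compared through their truncations, which are exact modulo q^(N+1).

module Submission where

open import Defs
open import Algebra.Bundles using (CommutativeMonoid)
import Algebra.Solver.CommutativeMonoid as CommutativeMonoidSolver
open import Data.Bool using (true; false)
open import Data.Empty using (⊥-elim)
open import Data.Integer using (ℤ; +_; 0ℤ; 1ℤ; -_)
import Data.Integer as ℤ
import Data.Integer.Properties as ℤₚ
open import Data.Integer.Solver using (module +-*-Solver)
open import Data.List using (List; []; _∷_; _++_; map; length; head)
import Data.List.Properties as Listₚ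
open import Data.List.Membership.Propositional using (_∈_)
open import Data.List.Membership.Propositional.Properties
  using (∈-map⁺; ∈-map⁻; ∈-++⁺ˡ; ∈-++⁺ʳ; ∈-++⁻)
open import Data.List.Relation.Binary.Disjoint.Propositional using (Disjoint)
open import Data.List.Relation.Unary.All as All using (All; []; _∷_)
open import Data.List.Relation.Unary.AllPairs using ([]; _∷_)
open import Data.List.Relation.Unary.Any using (here)
open import Data.List.Relation.Unary.Linked as Linked using (Linked; []; [-]; _∷_; head′; _∷′_)
open import Data.List.Relation.Unary.Unique.Propositional using (Unique)
import Data.List.Relation.Unary.Unique.Propositional.Properties as Uniqueₚ
open import Data.Maybe using (just)
open import Data.Maybe.Relation.Binary.Connected using (Connected; just; just-nothing)
open import Data.Nat
  using ( ℕ; zero; suc; _+_; _*_; _∸_; _≤_; _<_; _≤′_; ≤′-refl; ≤′-step; z≤n; s≤s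
        ; _≤?_; _≟_; >-nonZero)
import Data.Nat.Properties as ℕₚ
open import Data.Nat.Divisibility
  using ( _∣_; _∣?_; divides; ∣⇒≤; ∣m+n∣m⇒∣n; ∣m∣n⇒∣m+n; ∣-refl; ∣-trans; n∣m*n; m∣m*n; 1∣_
        ; *-monoʳ-∣; *-cancelˡ-∣)
open import Data.Product using (Σ; ∃; _×_; _,_; proj₁; proj₂)
open import Data.Sum using (inj₁; inj₂)
open import Function using (_∘_)
open import Level using (0ℓ)
open import Function.Bundles using (_⇔_; mk⇔; Equivalence)
open import Relation.Binary.Bundles using (Setoid)
import Relation.Binary.Reasoning.Setoid as SetoidReasoning
open import Relation.Binary.PropositionalEquality
  using (_≡_; _≢_; refl; sym; trans; cong; cong₂; subst; _≗_; _→-setoid_; module ≡-Reasoning)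
open import Relation.Nullary using (¬_; Dec; yes; no)

series-setoid : Setoid 0ℓ 0ℓ
series-setoid = ℕ →-setoid ℤ

open Setoid series-setoid using () renaming (refl to ≗-refl; sym to ≗-sym; trans to ≗-trans)

shift : Series → Series
shift f n = f (suc n)

sumTo-cong : ∀ {f g} n → (∀ i → i ≤ n → f i ≡ g i) → sumTo f n ≡ sumTo g n
sumTo-cong zero f≡g = f≡g 0 z≤n
sumTo-cong (suc n) f≡g =
  cong₂ ℤ._+_ (sumTo-cong n λ i i≤n → f≡g i (ℕₚ.m≤n⇒m≤1+n i≤n)) (f≡g (suc n) ℕₚ.≤-refl)

sumTo-suc : ∀ f n → sumTo f (suc n) ≡ f 0 ℤ.+ sumTo (shift f) n
sumTo-suc f zero = refl
sumTo-suc f (suc n) =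
  trans (cong (ℤ._+ f (suc (suc n))) (sumTo-suc f n)) (ℤₚ.+-assoc (f 0) _ _)

sumTo-⊕ : ∀ f g n → sumTo (f ⊕ g) n ≡ sumTo f n ℤ.+ sumTo g n
sumTo-⊕ f g zero = refl
sumTo-⊕ f g (suc n) =
  trans (cong (ℤ._+ (f ⊕ g) (suc n)) (sumTo-⊕ f g n))
    (interchange (sumTo f n) (sumTo g n) (f (suc n)) (g (suc n)))
  where
  open +-*-Solver
  interchange : ∀ a b c d → (a ℤ.+ b) ℤ.+ (c ℤ.+ d) ≡ (a ℤ.+ c) ℤ.+ (b ℤ.+ d)
  interchange = solve 4 (λ a b c d → (a :+ b) :+ (c :+ d) := (a :+ c) :+ (b :+ d)) refl

sumTo-scale : ∀ c f n → sumTo (scale c f) n ≡ c ℤ.* sumTo f n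
sumTo-scale c f zero = refl
sumTo-scale c f (suc n) =
  trans (cong (ℤ._+ c ℤ.* f (suc n)) (sumTo-scale c f n)) (sym (ℤₚ.*-distribˡ-+ c _ _))

sumTo-neg : ∀ f n → sumTo (λ i → - f i) n ≡ - sumTo f n
sumTo-neg f zero = refl
sumTo-neg f (suc n) =
  trans (cong (ℤ._+ - f (suc n)) (sumTo-neg f n)) (sym (ℤₚ.neg-distrib-+ (sumTo f n) _))

sumTo-⊝ : ∀ f g n → sumTo (f ⊝ g) n ≡ sumTo f n ℤ.- sumTo g n
sumTo-⊝ f g n = trans (sumTo-⊕ f (λ i → - g i) n) (cong (ℤ._+_ (sumTo f n)) (sumTo-neg g n))

⊛-sucˡ : ∀ f g n → (f ⊛ g) (suc n) ≡ f 0 ℤ.* g (suc n) ℤ.+ (shift f ⊛ g) n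
⊛-sucˡ f g n = sumTo-suc (λ i → f i ℤ.* g (suc n ∸ i)) n

⊛-sucʳ : ∀ f g n → (f ⊛ g) (suc n) ≡ (f ⊛ shift g) n ℤ.+ f (suc n) ℤ.* g 0
⊛-sucʳ f g n = cong₂ ℤ._+_
  (sumTo-cong n λ i i≤n → cong (λ k → f i ℤ.* g k) (ℕₚ.+-∸-assoc 1 i≤n))
  (cong (λ k → f (suc n) ℤ.* g k) (ℕₚ.n∸n≡0 n))

⊛-cong : ∀ {f f′ g g′} → f ≗ f′ → g ≗ g′ → f ⊛ g ≗ f′ ⊛ g′
⊛-cong f≗f′ g≗g′ n = sumTo-cong n λ i _ → cong₂ ℤ._*_ (f≗f′ i) (g≗g′ (n ∸ i))

⊕-cong : ∀ {f f′ g g′} → f ≗ f′ → g ≗ g′ → f ⊕ g ≗ f′ ⊕ g′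
⊕-cong f≗f′ g≗g′ n = cong₂ ℤ._+_ (f≗f′ n) (g≗g′ n)

⊛-comm : ∀ f g → f ⊛ g ≗ g ⊛ f
⊛-comm f g zero = ℤₚ.*-comm (f 0) (g 0)
⊛-comm f g (suc n) = begin
  (f ⊛ g) (suc n)                          ≡⟨ ⊛-sucˡ f g n ⟩
  f 0 ℤ.* g (suc n) ℤ.+ (shift f ⊛ g) n    ≡⟨ cong₂ ℤ._+_ (ℤₚ.*-comm (f 0) _) (⊛-comm (shift f) g n) ⟩
  g (suc n) ℤ.* f 0 ℤ.+ (g ⊛ shift f) n    ≡⟨ ℤₚ.+-comm _ ((g ⊛ shift f) n) ⟩
  (g ⊛ shift f) n ℤ.+ g (suc n) ℤ.* f 0    ≡⟨ ⊛-sucʳ g f n ⟨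
  (g ⊛ f) (suc n)                          ∎
  where open ≡-Reasoning

⊛-scaleˡ : ∀ c f g → scale c f ⊛ g ≗ scale c (f ⊛ g)
⊛-scaleˡ c f g n =
  trans (sumTo-cong n λ i _ → ℤₚ.*-assoc c (f i) (g (n ∸ i))) (sumTo-scale c _ n)

⊛-distribʳ-⊕ : ∀ f g h → (f ⊕ g) ⊛ h ≗ f ⊛ h ⊕ g ⊛ h
⊛-distribʳ-⊕ f g h n =
  trans (sumTo-cong n λ i _ → ℤₚ.*-distribʳ-+ (h (n ∸ i)) (f i) (g i)) (sumTo-⊕ _ _ n)

⊛-distribʳ-⊝ : ∀ f g h → (f ⊝ g) ⊛ h ≗ f ⊛ h ⊝ g ⊛ h
⊛-distribʳ-⊝ f g h n = trans (sumTo-cong n λ i _ → distrib (f i) (g i) (h (n ∸ i)))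
  (sumTo-⊝ (λ i → f i ℤ.* h (n ∸ i)) (λ i → g i ℤ.* h (n ∸ i)) n)
  where
  open +-*-Solver
  distrib : ∀ a b c → (a ℤ.- b) ℤ.* c ≡ a ℤ.* c ℤ.- b ℤ.* c
  distrib = solve 3 (λ a b c → (a :- b) :* c := a :* c :- b :* c) refl

⊛-identityˡ : ∀ f → one ⊛ f ≗ f
⊛-identityˡ f zero = ℤₚ.*-identityˡ (f 0)
⊛-identityˡ f (suc n) = begin
  (one ⊛ f) (suc n)                            ≡⟨ ⊛-sucˡ one f n ⟩
  1ℤ ℤ.* f (suc n) ℤ.+ (shift one ⊛ f) n
    -- shift one is pointwise 0ℤ, so its convolution is 0ℤ times a sum
    ≡⟨ cong₂ ℤ._+_ (ℤₚ.*-identityˡ (f (suc n))) (sumTo-scale 0ℤ (λ i → f (n ∸ i)) n) ⟩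
  f (suc n) ℤ.+ 0ℤ                             ≡⟨ ℤₚ.+-identityʳ _ ⟩
  f (suc n)                                    ∎
  where open ≡-Reasoning

⊛-identityʳ : ∀ f → f ⊛ one ≗ f
⊛-identityʳ f n = trans (⊛-comm f one n) (⊛-identityˡ f n)

⊛-assoc : ∀ f g h → (f ⊛ g) ⊛ h ≗ f ⊛ (g ⊛ h)
⊛-assoc f g h zero = ℤₚ.*-assoc (f 0) (g 0) (h 0)
⊛-assoc f g h (suc n) = begin
  ((f ⊛ g) ⊛ h) (suc n)
    ≡⟨ ⊛-sucˡ (f ⊛ g) h n ⟩
  f 0 ℤ.* g 0 ℤ.* h (suc n) ℤ.+ (shift (f ⊛ g) ⊛ h) n
    ≡⟨ cong (ℤ._+_ (f 0 ℤ.* g 0 ℤ.* h (suc n))) (shift-⊛ n) ⟩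
  f 0 ℤ.* g 0 ℤ.* h (suc n) ℤ.+ (f 0 ℤ.* (shift g ⊛ h) n ℤ.+ (shift f ⊛ (g ⊛ h)) n)
    ≡⟨ regroup (f 0) (g 0) (h (suc n)) _ _ ⟩
  f 0 ℤ.* (g 0 ℤ.* h (suc n) ℤ.+ (shift g ⊛ h) n) ℤ.+ (shift f ⊛ (g ⊛ h)) n
    ≡⟨ cong (λ x → f 0 ℤ.* x ℤ.+ (shift f ⊛ (g ⊛ h)) n) (⊛-sucˡ g h n) ⟨
  f 0 ℤ.* (g ⊛ h) (suc n) ℤ.+ (shift f ⊛ (g ⊛ h)) n
    ≡⟨ ⊛-sucˡ f (g ⊛ h) n ⟨
  (f ⊛ (g ⊛ h)) (suc n) ∎
  where
  open ≡-Reasoning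
  shift-⊛ : (shift (f ⊛ g) ⊛ h) ≗ scale (f 0) (shift g ⊛ h) ⊕ shift f ⊛ (g ⊛ h)
  shift-⊛ m = begin
    (shift (f ⊛ g) ⊛ h) m                               ≡⟨ ⊛-cong {g = h} (⊛-sucˡ f g) ≗-refl m ⟩
    ((scale (f 0) (shift g) ⊕ shift f ⊛ g) ⊛ h) m       ≡⟨ ⊛-distribʳ-⊕ (scale (f 0) (shift g)) (shift f ⊛ g) h m ⟩
    (scale (f 0) (shift g) ⊛ h) m ℤ.+ ((shift f ⊛ g) ⊛ h) m
      ≡⟨ cong₂ ℤ._+_ (⊛-scaleˡ (f 0) (shift g) h m) (⊛-assoc (shift f) g h m) ⟩
    f 0 ℤ.* (shift g ⊛ h) m ℤ.+ (shift f ⊛ (g ⊛ h)) m  ∎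
  open +-*-Solver
  regroup : ∀ a b c d e → a ℤ.* b ℤ.* c ℤ.+ (a ℤ.* d ℤ.+ e) ≡ a ℤ.* (b ℤ.* c ℤ.+ d) ℤ.+ e
  regroup = solve 5 (λ a b c d e → a :* b :* c :+ (a :* d :+ e) := a :* (b :* c :+ d) :+ e) refl

⊛-distribˡ-⊕ : ∀ f g h → f ⊛ (g ⊕ h) ≗ f ⊛ g ⊕ f ⊛ h
⊛-distribˡ-⊕ f g h n = begin
  (f ⊛ (g ⊕ h)) n                 ≡⟨ ⊛-comm f (g ⊕ h) n ⟩
  ((g ⊕ h) ⊛ f) n                 ≡⟨ ⊛-distribʳ-⊕ g h f n ⟩
  (g ⊛ f) n ℤ.+ (h ⊛ f) n         ≡⟨ cong₂ ℤ._+_ (⊛-comm g f n) (⊛-comm h f n) ⟩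
  (f ⊛ g) n ℤ.+ (f ⊛ h) n         ∎
  where open ≡-Reasoning

series-⊛-commutativeMonoid : CommutativeMonoid 0ℓ 0ℓ
series-⊛-commutativeMonoid = record
  { Carrier = Series
  ; _≈_ = _≗_
  ; _∙_ = _⊛_
  ; ε = one
  ; isCommutativeMonoid = record
    { isMonoid = record
      { isSemigroup = record
        { isMagma = record { isEquivalence = Setoid.isEquivalence series-setoid ; ∙-cong = ⊛-cong }
        ; assoc = ⊛-assoc
        }
      ; identity = ⊛-identityˡ , ⊛-identityʳ
      }
    ; comm = ⊛-comm
    }
  }

module ⊛-Solver = CommutativeMonoidSolver series-⊛-commutativeMonoid
module ≗-Reasoning = SetoidReasoning series-setoid

mono-≡ : ∀ {a n} → n ≡ a → mono a n ≡ 1ℤ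
mono-≡ {a} {n} n≡a with n ≟ a
... | yes _ = refl
... | no n≢a = ⊥-elim (n≢a n≡a)

mono-≢ : ∀ {a n} → n ≢ a → mono a n ≡ 0ℤ
mono-≢ {a} {n} n≢a with n ≟ a
... | yes n≡a = ⊥-elim (n≢a n≡a)
... | no _ = refl

mono-reindex : ∀ {a n b m} → (n ≡ a ⇔ m ≡ b) → mono a n ≡ mono b m
mono-reindex {a} {n} n≡a⇔m≡b with n ≟ a
... | yes n≡a = sym (mono-≡ (Equivalence.to n≡a⇔m≡b n≡a))
... | no n≢a = sym (mono-≢ (n≢a ∘ Equivalence.from n≡a⇔m≡b))

geom-∣ : ∀ {a n} → a ∣ n → geom a n ≡ 1ℤ
geom-∣ {a} {n} a∣n with a ∣? n
... | yes _ = refl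
... | no a∤n = ⊥-elim (a∤n a∣n)

geom-∤ : ∀ {a n} → ¬ a ∣ n → geom a n ≡ 0ℤ
geom-∤ {a} {n} a∤n with a ∣? n
... | yes a∣n = ⊥-elim (a∤n a∣n)
... | no _ = refl

shift-mono : ∀ a → shift (mono (suc a)) ≗ mono a
shift-mono a n = mono-reindex (mk⇔ ℕₚ.suc-injective (cong suc))

mono-suc-⊛ : ∀ a g n → (mono (suc a) ⊛ g) (suc n) ≡ (mono a ⊛ g) n
mono-suc-⊛ a g n = begin
  (mono (suc a) ⊛ g) (suc n)                                       ≡⟨ ⊛-sucˡ (mono (suc a)) g n ⟩
  0ℤ ℤ.+ (shift (mono (suc a)) ⊛ g) n                              ≡⟨ ℤₚ.+-identityˡ _ ⟩
  (shift (mono (suc a)) ⊛ g) n                                     ≡⟨ ⊛-cong {g = g} (shift-mono a) ≗-refl n ⟩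
  (mono a ⊛ g) n                                                   ∎
  where open ≡-Reasoning

mono-⊛ : ∀ {a n} g → a ≤ n → (mono a ⊛ g) n ≡ g (n ∸ a)
mono-⊛ {zero} g _ = ⊛-identityˡ g _
mono-⊛ {suc a} {suc n} g (s≤s a≤n) = trans (mono-suc-⊛ a g n) (mono-⊛ g a≤n)

mono-⊛-< : ∀ {a n} g → n < a → (mono a ⊛ g) n ≡ 0ℤ
mono-⊛-< {suc a} {zero} g _ = refl
mono-⊛-< {suc a} {suc n} g (s≤s n<a) = trans (mono-suc-⊛ a g n) (mono-⊛-< g n<a)

mono-⊛-mono : ∀ a b → mono a ⊛ mono b ≗ mono (a + b)
mono-⊛-mono a b n with a ≤? n
... | yes a≤n = trans (mono-⊛ (mono b) a≤n) (mono-reindex (mk⇔ to from))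
  where
  to : n ∸ a ≡ b → n ≡ a + b
  to n∸a≡b = trans (sym (ℕₚ.m+[n∸m]≡n a≤n)) (cong (_+_ a) n∸a≡b)
  from : n ≡ a + b → n ∸ a ≡ b
  from n≡a+b = trans (cong (_∸ a) n≡a+b) (ℕₚ.m+n∸m≡n a b)
... | no a≰n = trans (mono-⊛-< (mono b) (ℕₚ.≰⇒> a≰n))
                     (sym (mono-≢ λ n≡a+b → a≰n (subst (a ≤_) (sym n≡a+b) (ℕₚ.m≤m+n a b))))

geom-∸ : ∀ {a n} → a ≤ n → geom a n ≡ geom a (n ∸ a)
geom-∸ {a} {n} a≤n with a ∣? n
... | yes a∣n = sym (geom-∣ (∣m+n∣m⇒∣n (subst (a ∣_) (sym (ℕₚ.m+[n∸m]≡n a≤n)) a∣n) ∣-refl))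
... | no a∤n =
  sym (geom-∤ λ a∣n∸a → a∤n (subst (a ∣_) (ℕₚ.m+[n∸m]≡n a≤n) (∣m∣n⇒∣m+n ∣-refl a∣n∸a)))

geom-unfold : ∀ {a} → 1 ≤ a → geom a ≗ one ⊕ mono a ⊛ geom a
geom-unfold {a} 1≤a zero = begin
  geom a 0                          ≡⟨ geom-∣ (divides 0 refl) ⟩
  1ℤ                                ≡⟨ cong (λ x → 1ℤ ℤ.+ x ℤ.* geom a 0) (mono-≢ (ℕₚ.<⇒≢ 1≤a)) ⟨
  1ℤ ℤ.+ mono a 0 ℤ.* geom a 0      ∎
  where open ≡-Reasoning
geom-unfold {a} 1≤a (suc n) with a ≤? suc n
... | yes a≤n = trans (geom-∸ a≤n) (trans (sym (mono-⊛ (geom a) a≤n)) (sym (ℤₚ.+-identityˡ _)))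
... | no a≰n =
  trans (geom-∤ (a≰n ∘ ∣⇒≤)) (sym (trans (ℤₚ.+-identityˡ _) (mono-⊛-< (geom a) (ℕₚ.≰⇒> a≰n))))

⊛-geom-unfold : ∀ {a} → 1 ≤ a → ∀ f → f ⊛ geom a ≗ f ⊕ mono a ⊛ (f ⊛ geom a)
⊛-geom-unfold {a} 1≤a f = begin
  f ⊛ geom a                        ≈⟨ ⊛-cong {f = f} ≗-refl (geom-unfold 1≤a) ⟩
  f ⊛ (one ⊕ mono a ⊛ geom a)       ≈⟨ ⊛-distribˡ-⊕ f one (mono a ⊛ geom a) ⟩
  f ⊛ one ⊕ f ⊛ (mono a ⊛ geom a)
    ≈⟨ ⊕-cong (⊛-identityʳ f)
              (solve 3 (λ f m g → f ⊕' (m ⊕' g) ⊜ m ⊕' (f ⊕' g)) ≗-refl f (mono a) (geom a)) ⟩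
  f ⊕ mono a ⊛ (f ⊛ geom a)         ∎
  where
  open ≗-Reasoning
  open ⊛-Solver using (solve; _⊜_) renaming (_⊕_ to _⊕'_)

oneMinus-⊛-geom : ∀ {a} → 1 ≤ a → oneMinus a ⊛ geom a ≗ one
oneMinus-⊛-geom {a} 1≤a n = begin
  (oneMinus a ⊛ geom a) n                                ≡⟨ ⊛-distribʳ-⊝ one (mono a) (geom a) n ⟩
  (one ⊛ geom a) n ℤ.- (mono a ⊛ geom a) n               ≡⟨ cong (λ x → x ℤ.- (mono a ⊛ geom a) n) geom-as-sum ⟩
  one n ℤ.+ (mono a ⊛ geom a) n ℤ.- (mono a ⊛ geom a) n  ≡⟨ cancel (one n) _ ⟩
  one n                                                  ∎
  where
  open ≡-Reasoning
  geom-as-sum : (one ⊛ geom a) n ≡ one n ℤ.+ (mono a ⊛ geom a) n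
  geom-as-sum = trans (⊛-identityˡ (geom a) n) (geom-unfold 1≤a n)
  open +-*-Solver
  cancel : ∀ x y → x ℤ.+ y ℤ.- y ≡ x
  cancel = solve 2 (λ x y → x :+ y :- y := x) refl

double : ∀ n → 2 * n ≡ n + n
double n = cong (_+_ n) (ℕₚ.+-identityʳ n)

-- (1 + q^j)/(1 - q^j) = 1 + 2q^j + 2q^(2j) + ⋯ accounts for the parts of size j of an overpartition.
overpartFactor : ℕ → Series
overpartFactor j = (one ⊕ mono j) ⊛ geom j

invOverpartFactor : ℕ → Series
invOverpartFactor j = oneMinus j ⊛ oneMinus j ⊛ geom (2 * j)

onePlus-⊛-oneMinus : ∀ j → (one ⊕ mono j) ⊛ oneMinus j ≗ oneMinus (2 * j)
onePlus-⊛-oneMinus j n = begin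
  ((one ⊕ mono j) ⊛ oneMinus j) n                                ≡⟨ ⊛-distribʳ-⊕ one (mono j) (oneMinus j) n ⟩
  (one ⊛ oneMinus j) n ℤ.+ (mono j ⊛ oneMinus j) n
    ≡⟨ cong₂ ℤ._+_ (⊛-identityˡ (oneMinus j) n) (⊛-comm (mono j) (oneMinus j) n) ⟩
  oneMinus j n ℤ.+ (oneMinus j ⊛ mono j) n
    ≡⟨ cong (ℤ._+_ (oneMinus j n)) (⊛-distribʳ-⊝ one (mono j) (mono j) n) ⟩
  oneMinus j n ℤ.+ ((one ⊛ mono j) n ℤ.- (mono j ⊛ mono j) n)
    ≡⟨ cong₂ (λ x y → oneMinus j n ℤ.+ (x ℤ.- y)) (⊛-identityˡ (mono j) n) mono-double ⟩
  (one n ℤ.- mono j n) ℤ.+ (mono j n ℤ.- mono (2 * j) n)        ≡⟨ ℤₚ.+-minus-telescope (one n) (mono j n) _ ⟩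
  oneMinus (2 * j) n                                             ∎
  where
  open ≡-Reasoning
  mono-double : (mono j ⊛ mono j) n ≡ mono (2 * j) n
  mono-double = trans (mono-⊛-mono j j n) (cong (λ k → mono k n) (sym (double j)))

overpartFactor-expand : ∀ {j} → 1 ≤ j → oneMinus (2 * j) ⊛ geom j ⊛ geom j ≗ overpartFactor j
overpartFactor-expand {j} 1≤j = begin
  oneMinus (2 * j) ⊛ geom j ⊛ geom j
    ≈⟨ ⊛-cong {g = geom j} (⊛-cong {g = geom j} (≗-sym (onePlus-⊛-oneMinus j)) ≗-refl) ≗-refl ⟩
  (one ⊕ mono j) ⊛ oneMinus j ⊛ geom j ⊛ geom j
    ≈⟨ solve 3 (λ p o g → ((p ⊕' o) ⊕' g) ⊕' g ⊜ (p ⊕' g) ⊕' (o ⊕' g)) ≗-refl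
               (one ⊕ mono j) (oneMinus j) (geom j) ⟩
  overpartFactor j ⊛ (oneMinus j ⊛ geom j)             ≈⟨ ⊛-cong {f = overpartFactor j} ≗-refl (oneMinus-⊛-geom 1≤j) ⟩
  overpartFactor j ⊛ one                               ≈⟨ ⊛-identityʳ (overpartFactor j) ⟩
  overpartFactor j                                     ∎
  where
  open ≗-Reasoning
  open ⊛-Solver using (solve; _⊜_) renaming (_⊕_ to _⊕'_)

overpartFactor-inverse : ∀ {j} → 1 ≤ j → overpartFactor j ⊛ invOverpartFactor j ≗ one
overpartFactor-inverse {j} 1≤j = begin
  overpartFactor j ⊛ invOverpartFactor j
    ≈⟨ solve 4 (λ p g o G → (p ⊕' g) ⊕' ((o ⊕' o) ⊕' G) ⊜ ((p ⊕' o) ⊕' G) ⊕' (o ⊕' g)) ≗-refl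
               (one ⊕ mono j) (geom j) (oneMinus j) (geom (2 * j)) ⟩
  (one ⊕ mono j) ⊛ oneMinus j ⊛ geom (2 * j) ⊛ (oneMinus j ⊛ geom j)
    ≈⟨ ⊛-cong (⊛-cong {g = geom (2 * j)} (onePlus-⊛-oneMinus j) ≗-refl) (oneMinus-⊛-geom 1≤j) ⟩
  oneMinus (2 * j) ⊛ geom (2 * j) ⊛ one                ≈⟨ ⊛-identityʳ _ ⟩
  oneMinus (2 * j) ⊛ geom (2 * j)                      ≈⟨ oneMinus-⊛-geom (ℕₚ.≤-trans 1≤j (ℕₚ.m≤n*m j 2)) ⟩
  one                                                  ∎
  where
  open ≗-Reasoning
  open ⊛-Solver using (solve; _⊜_) renaming (_⊕_ to _⊕'_)

infix 4 _≡_[mod-q^_]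
_≡_[mod-q^_] : Series → Series → ℕ → Set
f ≡ g [mod-q^ b ] = ∀ i → i < b → f i ≡ g i

module _ {b : ℕ} where

  ≗⇒≡-mod : ∀ {f g} → f ≗ g → f ≡ g [mod-q^ b ]
  ≗⇒≡-mod f≗g i _ = f≗g i

  ≡-mod-sym : ∀ {f g} → f ≡ g [mod-q^ b ] → g ≡ f [mod-q^ b ]
  ≡-mod-sym f≡g i i<b = sym (f≡g i i<b)

  ≡-mod-trans : ∀ {f g h} → f ≡ g [mod-q^ b ] → g ≡ h [mod-q^ b ] → f ≡ h [mod-q^ b ]
  ≡-mod-trans f≡g g≡h i i<b = trans (f≡g i i<b) (g≡h i i<b)

  ≡-mod-weaken : ∀ {c f g} → c ≤ b → f ≡ g [mod-q^ b ] → f ≡ g [mod-q^ c ]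
  ≡-mod-weaken c≤b f≡g i i<c = f≡g i (ℕₚ.<-≤-trans i<c c≤b)

  ⊛-cong-mod : ∀ {f f′ g g′} → f ≡ f′ [mod-q^ b ] → g ≡ g′ [mod-q^ b ] →
               f ⊛ g ≡ f′ ⊛ g′ [mod-q^ b ]
  ⊛-cong-mod f≡f′ g≡g′ n n<b = sumTo-cong n λ i i≤n →
    cong₂ ℤ._*_ (f≡f′ i (ℕₚ.≤-<-trans i≤n n<b)) (g≡g′ (n ∸ i) (ℕₚ.≤-<-trans (ℕₚ.m∸n≤m n i) n<b))

  ⊛-≡1-mod : ∀ {f g} → f ≡ one [mod-q^ b ] → g ≡ one [mod-q^ b ] → f ⊛ g ≡ one [mod-q^ b ]
  ⊛-≡1-mod f≡1 g≡1 = ≡-mod-trans (⊛-cong-mod f≡1 g≡1) (≗⇒≡-mod (⊛-identityˡ one))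

  mono-⊛-cong-mod : ∀ {a f g} → f ≡ g [mod-q^ b ] → mono a ⊛ f ≡ mono a ⊛ g [mod-q^ a + b ]
  mono-⊛-cong-mod {a} {f} {g} f≡g i i<a+b with a ≤? i
  ... | yes a≤i = trans (mono-⊛ f a≤i) (trans (f≡g (i ∸ a) i∸a<b) (sym (mono-⊛ g a≤i)))
    where
    i∸a<b : i ∸ a < b
    i∸a<b = subst (i ∸ a <_) (ℕₚ.m+n∸m≡n a b) (ℕₚ.∸-monoˡ-< i<a+b a≤i)
  ... | no a≰i = trans (mono-⊛-< f (ℕₚ.≰⇒> a≰i)) (sym (mono-⊛-< g (ℕₚ.≰⇒> a≰i)))

  oneMinus-≡1-mod : oneMinus b ≡ one [mod-q^ b ]
  oneMinus-≡1-mod i i<b =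
    trans (cong (λ x → one i ℤ.- x) (mono-≢ (ℕₚ.<⇒≢ i<b))) (ℤₚ.+-identityʳ (one i))

  geom-≡1-mod : geom b ≡ one [mod-q^ b ]
  geom-≡1-mod zero _ = geom-∣ (divides 0 refl)
  geom-≡1-mod (suc i) i<b = geom-∤ (ℕₚ.<⇒≱ i<b ∘ ∣⇒≤)

  overpartFactor-≡1-mod : overpartFactor b ≡ one [mod-q^ b ]
  overpartFactor-≡1-mod = ⊛-≡1-mod onePlus≡1 geom-≡1-mod
    where
    onePlus≡1 : one ⊕ mono b ≡ one [mod-q^ b ]
    onePlus≡1 i i<b = trans (cong (ℤ._+_ (one i)) (mono-≢ (ℕₚ.<⇒≢ i<b))) (ℤₚ.+-identityʳ (one i))

invOverpartFactor-≡1-mod : ∀ {b} → invOverpartFactor b ≡ one [mod-q^ b ]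
invOverpartFactor-≡1-mod {b} =
  ⊛-≡1-mod (⊛-≡1-mod oneMinus-≡1-mod oneMinus-≡1-mod)
           (≡-mod-weaken (ℕₚ.m≤n*m b 2) (geom-≡1-mod {2 * b}))

-- The factors k > n of ∏ F then do not affect its coefficient of q^n.
Convergent : (ℕ → Series) → Set
Convergent F = ∀ k → F k ≡ one [mod-q^ k ]

convergent-∘-* : ∀ {a F} → 1 ≤ a → Convergent F → Convergent (λ k → F (a * k))
convergent-∘-* {a} 1≤a conv k = ≡-mod-weaken (ℕₚ.m≤n*m k a {{>-nonZero 1≤a}}) (conv (a * k))

∏ : (ℕ → Series) → Series
∏ F n = prodTo F n n

prodTo-cong : ∀ {F G} → (∀ k → F (suc k) ≗ G (suc k)) → ∀ N → prodTo F N ≗ prodTo G N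
prodTo-cong F≗G zero = ≗-refl
prodTo-cong F≗G (suc N) = ⊛-cong (prodTo-cong F≗G N) (F≗G N)

prodTo-⊛ : ∀ F G N → prodTo (λ k → F k ⊛ G k) N ≗ prodTo F N ⊛ prodTo G N
prodTo-⊛ F G zero = ≗-sym (⊛-identityˡ one)
prodTo-⊛ F G (suc N) = ≗-trans (⊛-cong {g = F (suc N) ⊛ G (suc N)} (prodTo-⊛ F G N) ≗-refl)
  (solve 4 (λ a b c d → (a ⊕' b) ⊕' (c ⊕' d) ⊜ (a ⊕' c) ⊕' (b ⊕' d)) ≗-refl
     (prodTo F N) (prodTo G N) (F (suc N)) (G (suc N)))
  where open ⊛-Solver using (solve; _⊜_) renaming (_⊕_ to _⊕'_)

prodTo-stable : ∀ {F N M} → Convergent F → N ≤′ M → prodTo F M ≡ prodTo F N [mod-q^ suc N ]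
prodTo-stable conv ≤′-refl = ≗⇒≡-mod ≗-refl
prodTo-stable {F} {N} {suc M} conv (≤′-step N≤M) = ≡-mod-trans
  (⊛-cong-mod {f = prodTo F M} (≗⇒≡-mod ≗-refl) (≡-mod-weaken (s≤s (ℕₚ.≤′⇒≤ N≤M)) (conv (suc M))))
  (≡-mod-trans (≗⇒≡-mod (⊛-identityʳ (prodTo F M))) (prodTo-stable conv N≤M))

prodTo-skip : ∀ {F M} d → (∀ i → i < d → F (suc (i + M)) ≗ one) → prodTo F (d + M) ≗ prodTo F M
prodTo-skip zero _ = ≗-refl
prodTo-skip {F} {M} (suc d) trivial = begin
  prodTo F (d + M) ⊛ F (suc (d + M))   ≈⟨ ⊛-cong {f = prodTo F (d + M)} ≗-refl (trivial d (ℕₚ.n<1+n d)) ⟩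
  prodTo F (d + M) ⊛ one               ≈⟨ ⊛-identityʳ _ ⟩
  prodTo F (d + M)                     ≈⟨ prodTo-skip d (λ i i<d → trivial i (ℕₚ.m<n⇒m<1+n i<d)) ⟩
  prodTo F M                           ∎
  where open ≗-Reasoning

infix 4 _IsProductOf_
_IsProductOf_ : Series → (ℕ → Series) → Set
P IsProductOf F = ∀ N → P ≡ prodTo F N [mod-q^ suc N ]

∏-isProduct : ∀ {F} → Convergent F → ∏ F IsProductOf F
∏-isProduct conv N i i≤N = sym (prodTo-stable conv (ℕₚ.≤⇒≤′ (ℕₚ.≤-pred i≤N)) i (ℕₚ.n<1+n i))

isProduct-⊛ : ∀ {P Q F G} → P IsProductOf F → Q IsProductOf G → P ⊛ Q IsProductOf (λ k → F k ⊛ G k)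
isProduct-⊛ {F = F} {G} P≡ Q≡ N =
  ≡-mod-trans (⊛-cong-mod (P≡ N) (Q≡ N)) (≗⇒≡-mod (≗-sym (prodTo-⊛ F G N)))

isProduct-unique : ∀ {P Q F G} → P IsProductOf F → Q IsProductOf G →
                   (∀ k → F (suc k) ≗ G (suc k)) → P ≗ Q
isProduct-unique P≡ Q≡ F≗G n =
  trans (P≡ n n (ℕₚ.n<1+n n)) (trans (prodTo-cong F≗G n n) (sym (Q≡ n n (ℕₚ.n<1+n n))))

∏-cong : ∀ {F G} → (∀ k → F (suc k) ≗ G (suc k)) → ∏ F ≗ ∏ G
∏-cong F≗G n = prodTo-cong F≗G n n

poch-isProduct : ∀ {a} → 1 ≤ a → poch a IsProductOf (λ k → oneMinus (a * k))
poch-isProduct 1≤a = ∏-isProduct (convergent-∘-* 1≤a λ _ → oneMinus-≡1-mod)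

invPoch-isProduct : ∀ {a} → 1 ≤ a → invPoch a IsProductOf (λ k → geom (a * k))
invPoch-isProduct 1≤a = ∏-isProduct (convergent-∘-* 1≤a λ _ → geom-≡1-mod)

∏-multiples : ∀ {ℓ F} → 1 ≤ ℓ → Convergent F → (∀ k → ¬ ℓ ∣ k → F k ≗ one) →
              ∏ F ≗ ∏ (λ j → F (j * ℓ))
∏-multiples {suc r} {F} _ conv trivial n =
  trans (sym (prodTo-stable conv (ℕₚ.≤⇒≤′ (ℕₚ.m≤m*n n (suc r))) n (ℕₚ.n<1+n n))) (prodTo-multiples n n)
  where
  off-multiple : ∀ N i → i < r → ¬ suc r ∣ suc (i + N * suc r)
  off-multiple N i i<r ℓ∣ = ℕₚ.<⇒≱ i<r (ℕₚ.≤-pred (∣⇒≤ ℓ∣1+i))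
    where
    ℓ∣1+i : suc r ∣ suc i
    ℓ∣1+i = ∣m+n∣m⇒∣n (subst (suc r ∣_) (ℕₚ.+-comm (suc i) (N * suc r)) ℓ∣) (n∣m*n N)
  prodTo-multiples : ∀ N → prodTo F (N * suc r) ≗ prodTo (λ j → F (j * suc r)) N
  prodTo-multiples zero = ≗-refl
  prodTo-multiples (suc N) = ⊛-cong {g = F (suc N * suc r)}
    (≗-trans (prodTo-skip r (λ i i<r → trivial _ (off-multiple N i i<r))) (prodTo-multiples N)) ≗-refl

data Parity : ℕ → Set where
  even : ∀ k → Parity (2 * k)
  odd  : ∀ k → Parity (suc (2 * k))

parity : ∀ n → Parity n
parity zero = even 0
parity (suc n) with parity n
... | even k = odd k
... | odd k = subst Parity (ℕₚ.*-suc 2 k) (even (suc k))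

dilate : Series → Series
dilate F zero = F 0
dilate F (suc zero) = 0ℤ
dilate F (suc (suc n)) = dilate (shift F) n

dilate-even : ∀ F k → dilate F (2 * k) ≡ F k
dilate-even F zero = refl
dilate-even F (suc k) = trans (cong (dilate F) (ℕₚ.*-suc 2 k)) (dilate-even (shift F) k)

dilate-odd : ∀ F k → dilate F (suc (2 * k)) ≡ 0ℤ
dilate-odd F zero = refl
dilate-odd F (suc k) = trans (cong (dilate F ∘ suc) (ℕₚ.*-suc 2 k)) (dilate-odd (shift F) k)

dilate-unique : ∀ {F G} → (∀ k → G (2 * k) ≡ F k) → (∀ k → G (suc (2 * k)) ≡ 0ℤ) → G ≗ dilate F
dilate-unique {F} G-even G-odd n with parity n
... | even k = trans (G-even k) (sym (dilate-even F k))
... | odd k = trans (G-odd k) (sym (dilate-odd F k))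

dilate-cong-mod : ∀ {b f g} → f ≡ g [mod-q^ b ] → dilate f ≡ dilate g [mod-q^ b ]
dilate-cong-mod {f = f} {g} f≡g n n<b with parity n
... | even k = trans (dilate-even f k)
                 (trans (f≡g k (ℕₚ.≤-<-trans (ℕₚ.m≤n*m k 2) n<b)) (sym (dilate-even g k)))
... | odd k = trans (dilate-odd f k) (sym (dilate-odd g k))

dilate-cong : ∀ {f g} → f ≗ g → dilate f ≗ dilate g
dilate-cong f≗g n = dilate-cong-mod (≗⇒≡-mod f≗g) n (ℕₚ.n<1+n n)

module _ {F′ F G′ G : Series} (F′≗ : F′ ≗ dilate F) (G′≗ : G′ ≗ dilate G) where

  private
    F′-even : ∀ k → F′ (2 * k) ≡ F k
    F′-even k = trans (F′≗ (2 * k)) (dilate-even F k)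
    G′-even : ∀ k → G′ (2 * k) ≡ G k
    G′-even k = trans (G′≗ (2 * k)) (dilate-even G k)
    F′-odd : ∀ k → F′ (suc (2 * k)) ≡ 0ℤ
    F′-odd k = trans (F′≗ (suc (2 * k))) (dilate-odd F k)
    G′-odd : ∀ k → G′ (suc (2 * k)) ≡ 0ℤ
    G′-odd k = trans (G′≗ (suc (2 * k))) (dilate-odd G k)

  dilate-⊕ : F′ ⊕ G′ ≗ dilate (F ⊕ G)
  dilate-⊕ = dilate-unique (λ k → cong₂ ℤ._+_ (F′-even k) (G′-even k))
                          (λ k → cong₂ ℤ._+_ (F′-odd k) (G′-odd k))

  dilate-⊝ : F′ ⊝ G′ ≗ dilate (F ⊝ G)
  dilate-⊝ = dilate-unique (λ k → cong₂ ℤ._-_ (F′-even k) (G′-even k))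
                          (λ k → cong₂ ℤ._-_ (F′-odd k) (G′-odd k))

dilate-scale : ∀ c {F′ F} → F′ ≗ dilate F → scale c F′ ≗ dilate (scale c F)
dilate-scale c {F′} {F} F′≗ = dilate-unique
  (λ k → cong (ℤ._*_ c) (trans (F′≗ (2 * k)) (dilate-even F k)))
  (λ k → trans (cong (ℤ._*_ c) (trans (F′≗ (suc (2 * k))) (dilate-odd F k))) (ℤₚ.*-zeroʳ c))

dilate-⊛-hom : ∀ F G → dilate F ⊛ dilate G ≗ dilate (F ⊛ G)
dilate-⊛-hom F G zero = refl
dilate-⊛-hom F G (suc zero) = cong₂ ℤ._+_ (ℤₚ.*-zeroʳ (F 0)) refl
dilate-⊛-hom F G (suc (suc n)) = begin
  (dilate F ⊛ dilate G) (suc (suc n))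
    ≡⟨ ⊛-sucˡ (dilate F) (dilate G) (suc n) ⟩
  F 0 ℤ.* dilate (shift G) n ℤ.+ (shift (dilate F) ⊛ dilate G) (suc n)
    ≡⟨ cong (ℤ._+_ (F 0 ℤ.* dilate (shift G) n))
            (trans (⊛-sucˡ (shift (dilate F)) (dilate G) n) (ℤₚ.+-identityˡ _)) ⟩
  F 0 ℤ.* dilate (shift G) n ℤ.+ (dilate (shift F) ⊛ dilate G) n
    ≡⟨ cong (ℤ._+_ (F 0 ℤ.* dilate (shift G) n)) (dilate-⊛-hom (shift F) G n) ⟩
  F 0 ℤ.* dilate (shift G) n ℤ.+ dilate (shift F ⊛ G) n
    ≡⟨ dilate-⊕ (dilate-scale (F 0) ≗-refl) ≗-refl n ⟩
  dilate (scale (F 0) (shift G) ⊕ shift F ⊛ G) n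
    ≡⟨ dilate-cong (⊛-sucˡ F G) n ⟨
  dilate (F ⊛ G) (suc (suc n)) ∎
  where open ≡-Reasoning

dilate-⊛ : ∀ {F′ F G′ G} → F′ ≗ dilate F → G′ ≗ dilate G → F′ ⊛ G′ ≗ dilate (F ⊛ G)
dilate-⊛ {F = F} {G = G} F′≗ G′≗ = ≗-trans (⊛-cong F′≗ G′≗) (dilate-⊛-hom F G)

dilate-mono : ∀ a → mono (2 * a) ≗ dilate (mono a)
dilate-mono a = dilate-unique at-even (λ k → mono-≢ (λ 1+2k≡2a → ℕₚ.even≢odd a k (sym 1+2k≡2a)))
  where
  at-even : ∀ k → mono (2 * a) (2 * k) ≡ mono a k
  at-even k = mono-reindex (mk⇔ (ℕₚ.*-cancelˡ-≡ k a 2) (cong (2 *_)))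

dilate-geom : ∀ a → geom (2 * a) ≗ dilate (geom a)
dilate-geom a = dilate-unique at-even (λ k → geom-∤ (2∤odd k ∘ ∣-trans (m∣m*n a)))
  where
  at-even : ∀ k → geom (2 * a) (2 * k) ≡ geom a k
  at-even k with a ∣? k
  ... | yes a∣k = geom-∣ (*-monoʳ-∣ 2 a∣k)
  ... | no a∤k = geom-∤ (a∤k ∘ *-cancelˡ-∣ 2)
  2∤odd : ∀ k → ¬ 2 ∣ suc (2 * k)
  2∤odd k (divides q 1+2k≡q*2) = ℕₚ.even≢odd q k (trans (ℕₚ.*-comm 2 q) (sym 1+2k≡q*2))

dilate-oneMinus : ∀ a → oneMinus (2 * a) ≗ dilate (oneMinus a)
dilate-oneMinus a = dilate-⊝ (dilate-mono 0) (dilate-mono a)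

∏-dilate : ∀ {F G} → Convergent G → (∀ k → F (suc k) ≗ dilate (G (suc k))) → ∏ F ≗ dilate (∏ G)
∏-dilate {F} {G} conv F≗ n =
  trans (prodTo-dilate n n) (dilate-cong-mod (≡-mod-sym (∏-isProduct conv n)) n (ℕₚ.n<1+n n))
  where
  prodTo-dilate : ∀ N → prodTo F N ≗ dilate (prodTo G N)
  prodTo-dilate zero = dilate-mono 0
  prodTo-dilate (suc N) = dilate-⊛ (prodTo-dilate N) (F≗ N)

dilate-poch : ∀ {a} → 1 ≤ a → poch (2 * a) ≗ dilate (poch a)
dilate-poch {a} 1≤a = ∏-dilate {F = λ k → oneMinus (2 * a * k)}
  (convergent-∘-* 1≤a λ _ → oneMinus-≡1-mod)
  (λ k → ≗-trans (λ n → cong (λ b → oneMinus b n) (ℕₚ.*-assoc 2 a (suc k))) (dilate-oneMinus (a * suc k)))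

dilate-invPoch : ∀ {a} → 1 ≤ a → invPoch (2 * a) ≗ dilate (invPoch a)
dilate-invPoch {a} 1≤a = ∏-dilate {F = λ k → geom (2 * a * k)}
  (convergent-∘-* 1≤a λ _ → geom-≡1-mod)
  (λ k → ≗-trans (λ n → cong (λ b → geom b n) (ℕₚ.*-assoc 2 a (suc k))) (dilate-geom (a * suc k)))

regularFactor : ℕ → ℕ → Series
regularFactor ℓ k with ℓ ∣? k
... | yes _ = one
... | no _ = overpartFactor k

regularFactor-convergent : ∀ ℓ → Convergent (regularFactor ℓ)
regularFactor-convergent ℓ k with ℓ ∣? k
... | yes _ = ≗⇒≡-mod ≗-refl
... | no _ = overpartFactor-≡1-mod

etaQuotient : ℕ → Series
etaQuotient ℓ = poch ℓ ⊛ poch ℓ ⊛ poch 2 ⊛ invPoch 1 ⊛ invPoch 1 ⊛ invPoch (2 * ℓ)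

module _ {ℓ : ℕ} (1≤ℓ : 1 ≤ ℓ) where

  private
    etaFactor : ℕ → Series
    etaFactor k =
      oneMinus (ℓ * k) ⊛ oneMinus (ℓ * k) ⊛ oneMinus (2 * k) ⊛ geom (1 * k) ⊛ geom (1 * k) ⊛ geom (2 * ℓ * k)

    multipleFactor : ℕ → Series
    multipleFactor k with ℓ ∣? k
    ... | yes _ = invOverpartFactor k
    ... | no _ = one

    etaQuotient-isProduct : etaQuotient ℓ IsProductOf etaFactor
    etaQuotient-isProduct = isProduct-⊛ (isProduct-⊛ (isProduct-⊛ (isProduct-⊛ (isProduct-⊛
      (poch-isProduct 1≤ℓ) (poch-isProduct 1≤ℓ)) (poch-isProduct {2} (s≤s z≤n)))
      (invPoch-isProduct ℕₚ.≤-refl)) (invPoch-isProduct ℕₚ.≤-refl))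
      (invPoch-isProduct (ℕₚ.≤-trans 1≤ℓ (ℕₚ.m≤n*m ℓ 2)))

    etaFactor-split : ∀ k → etaFactor (suc k) ≗ overpartFactor (suc k) ⊛ invOverpartFactor (ℓ * suc k)
    etaFactor-split k = begin
      etaFactor K
        ≈⟨ solve 6 (λ a b c d e f → ((((a ⊕' b) ⊕' c) ⊕' d) ⊕' e) ⊕' f
                                  ⊜ ((c ⊕' d) ⊕' e) ⊕' ((a ⊕' b) ⊕' f)) ≗-refl
             (oneMinus (ℓ * K)) (oneMinus (ℓ * K)) (oneMinus (2 * K))
             (geom (1 * K)) (geom (1 * K)) (geom (2 * ℓ * K)) ⟩
      oneMinus (2 * K) ⊛ geom (1 * K) ⊛ geom (1 * K) ⊛
        (oneMinus (ℓ * K) ⊛ oneMinus (ℓ * K) ⊛ geom (2 * ℓ * K))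
        ≡⟨ cong₂ (λ i j → oneMinus (2 * K) ⊛ geom i ⊛ geom i ⊛
                          (oneMinus (ℓ * K) ⊛ oneMinus (ℓ * K) ⊛ geom j))
                 (ℕₚ.*-identityˡ K) (ℕₚ.*-assoc 2 ℓ K) ⟩
      oneMinus (2 * K) ⊛ geom K ⊛ geom K ⊛ invOverpartFactor (ℓ * K)
        ≈⟨ ⊛-cong {g = invOverpartFactor (ℓ * K)} (overpartFactor-expand (s≤s z≤n)) ≗-refl ⟩
      overpartFactor K ⊛ invOverpartFactor (ℓ * K) ∎
      where
      K = suc k
      open ≗-Reasoning
      open ⊛-Solver using (solve; _⊜_) renaming (_⊕_ to _⊕'_)

    multipleFactor-convergent : Convergent multipleFactor
    multipleFactor-convergent k with ℓ ∣? k
    ... | yes _ = invOverpartFactor-≡1-mod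
    ... | no _ = ≗⇒≡-mod ≗-refl

    multipleFactor-off : ∀ k → ¬ ℓ ∣ k → multipleFactor k ≗ one
    multipleFactor-off k ℓ∤k with ℓ ∣? k
    ... | yes ℓ∣k = ⊥-elim (ℓ∤k ℓ∣k)
    ... | no _ = ≗-refl

    multipleFactor-on : ∀ j → multipleFactor (j * ℓ) ≗ invOverpartFactor (ℓ * j)
    multipleFactor-on j with ℓ ∣? j * ℓ
    ... | yes _ = λ n → cong (λ a → invOverpartFactor a n) (ℕₚ.*-comm j ℓ)
    ... | no ℓ∤jℓ = ⊥-elim (ℓ∤jℓ (n∣m*n j))

    overpartFactor-⊛-multipleFactor : ∀ k →
      overpartFactor (suc k) ⊛ multipleFactor (suc k) ≗ regularFactor ℓ (suc k)
    overpartFactor-⊛-multipleFactor k with ℓ ∣? suc k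
    ... | yes _ = overpartFactor-inverse (s≤s z≤n)
    ... | no _ = ⊛-identityʳ (overpartFactor (suc k))

    overpartFactor-convergent : Convergent overpartFactor
    overpartFactor-convergent _ = overpartFactor-≡1-mod

  etaQuotient≗∏regularFactor : etaQuotient ℓ ≗ ∏ (regularFactor ℓ)
  etaQuotient≗∏regularFactor = begin
    etaQuotient ℓ
      ≈⟨ isProduct-unique etaQuotient-isProduct
           (isProduct-⊛ (∏-isProduct overpartFactor-convergent)
                        (∏-isProduct (convergent-∘-* 1≤ℓ λ _ → invOverpartFactor-≡1-mod)))
           etaFactor-split ⟩
    ∏ overpartFactor ⊛ ∏ (λ k → invOverpartFactor (ℓ * k))
      ≈⟨ ⊛-cong {f = ∏ overpartFactor} ≗-refl (≗-sym multiples) ⟩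
    ∏ overpartFactor ⊛ ∏ multipleFactor
      ≈⟨ isProduct-unique
           (isProduct-⊛ (∏-isProduct overpartFactor-convergent) (∏-isProduct multipleFactor-convergent))
           (∏-isProduct (regularFactor-convergent ℓ)) overpartFactor-⊛-multipleFactor ⟩
    ∏ (regularFactor ℓ) ∎
    where
    open ≗-Reasoning
    multiples : ∏ multipleFactor ≗ ∏ (λ k → invOverpartFactor (ℓ * k))
    multiples = ≗-trans (∏-multiples 1≤ℓ multipleFactor-convergent multipleFactor-off)
                        (∏-cong (multipleFactor-on ∘ suc))

undilatedRhs : ℕ → Series
undilatedRhs ℓ = etaQuotient ℓ ⊝ scale (+ 2) (geom 1) ⊕ scale (+ 2) (mono ℓ ⊛ geom ℓ) ⊕ one

rhs-dilate : ∀ {ℓ} → 1 ≤ ℓ → rhs ℓ ≗ dilate (undilatedRhs ℓ)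
rhs-dilate {ℓ} 1≤ℓ =
  dilate-⊕ (dilate-⊕ (dilate-⊝ etaQuotient-dilate (dilate-scale (+ 2) (dilate-geom 1)))
                     (dilate-scale (+ 2) (dilate-⊛ (dilate-mono ℓ) (dilate-geom ℓ))))
           (dilate-mono 0)
  where
  1≤2ℓ : 1 ≤ 2 * ℓ
  1≤2ℓ = ℕₚ.≤-trans 1≤ℓ (ℕₚ.m≤n*m ℓ 2)
  invPoch-4ℓ : invPoch (4 * ℓ) ≗ dilate (invPoch (2 * ℓ))
  invPoch-4ℓ = ≗-trans (λ n → cong (λ a → invPoch a n) (ℕₚ.*-assoc 2 2 ℓ)) (dilate-invPoch 1≤2ℓ)
  etaQuotient-dilate : poch (2 * ℓ) ⊛ poch (2 * ℓ) ⊛ poch 4 ⊛ invPoch 2 ⊛ invPoch 2 ⊛ invPoch (4 * ℓ)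
                       ≗ dilate (etaQuotient ℓ)
  etaQuotient-dilate = dilate-⊛ (dilate-⊛ (dilate-⊛ (dilate-⊛ (dilate-⊛
    (dilate-poch 1≤ℓ) (dilate-poch 1≤ℓ)) (dilate-poch {2} (s≤s z≤n)))
    (dilate-invPoch {1} ℕₚ.≤-refl)) (dilate-invPoch {1} ℕₚ.≤-refl)) invPoch-4ℓ

Family : Set
Family = ℕ → List (List Part)

count : Family → Series
count G m = + length (G m)

withPart : Part → Family → Family
withPart p G m with size p ≤? m
... | yes _ = map (p ∷_) (G (m ∸ size p))
... | no _ = []

module _ (p : Part) (G : Family) where

  ∈-withPart⁻ : ∀ {m xs} → xs ∈ withPart p G m →
                ∃ λ ys → xs ≡ p ∷ ys × size p ≤ m × ys ∈ G (m ∸ size p)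
  ∈-withPart⁻ {m} xs∈ with size p ≤? m
  ∈-withPart⁻ {m} xs∈ | yes p≤m with ∈-map⁻ (p ∷_) xs∈
  ... | ys , ys∈ , refl = ys , refl , p≤m , ys∈
  ∈-withPart⁻ {m} () | no _

  ∈-withPart⁺ : ∀ {m ys} → size p ≤ m → ys ∈ G (m ∸ size p) → p ∷ ys ∈ withPart p G m
  ∈-withPart⁺ {m} p≤m ys∈ with size p ≤? m
  ... | yes _ = ∈-map⁺ (p ∷_) ys∈
  ... | no p≰m = ⊥-elim (p≰m p≤m)

  withPart-unique : (∀ m → Unique (G m)) → ∀ m → Unique (withPart p G m)
  withPart-unique G-unique m with size p ≤? m
  ... | yes _ = Uniqueₚ.map⁺ Listₚ.∷-injectiveʳ (G-unique _)
  ... | no _ = []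

count-withPart : ∀ p G → count (withPart p G) ≗ mono (size p) ⊛ count G
count-withPart p G m with size p ≤? m
... | yes p≤m = trans (cong +_ (Listₚ.length-map (p ∷_) (G (m ∸ size p)))) (sym (mono-⊛ (count G) p≤m))
... | no p≰m = sym (mono-⊛-< (count G) (ℕₚ.≰⇒> p≰m))

length-withPart-self : ∀ p G → length (withPart p G (size p)) ≡ length (G 0)
length-withPart-self p G with size p ≤? size p
... | yes _ =
  trans (Listₚ.length-map (p ∷_) (G (size p ∸ size p))) (cong (length ∘ G) (ℕₚ.n∸n≡0 (size p)))
... | no p≰p = ⊥-elim (p≰p ℕₚ.≤-refl)

-- Prefixes the members of G (m ∸ i * B) with i ≤ f non-overlined parts B; withCopies takes f = m,
-- which never binds.
withCopiesUpTo : ℕ → Family → ℕ → Family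
withCopiesUpTo B G zero = G
withCopiesUpTo B G (suc f) m = G m ++ withPart (B , false) (withCopiesUpTo B G f) m

withCopies : ℕ → Family → Family
withCopies B G m = withCopiesUpTo B G m m

count-withCopiesUpTo : ∀ {B} G → 1 ≤ B → ∀ f →
                       count (withCopiesUpTo B G f) ≡ count G ⊛ geom B [mod-q^ suc f ]
count-withCopiesUpTo {B} G 1≤B zero zero _ =
  sym (trans (cong (ℤ._*_ (count G 0)) (geom-∣ (divides 0 refl))) (ℤₚ.*-identityʳ _))
count-withCopiesUpTo G 1≤B zero (suc i) (s≤s ())
count-withCopiesUpTo {B} G 1≤B (suc f) i i<2+f = begin
  count (withCopiesUpTo B G (suc f)) i                                   ≡⟨ cong +_ (Listₚ.length-++ (G i)) ⟩
  count G i ℤ.+ count (withPart (B , false) (withCopiesUpTo B G f)) i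
    ≡⟨ cong (ℤ._+_ (count G i)) (count-withPart (B , false) (withCopiesUpTo B G f) i) ⟩
  count G i ℤ.+ (mono B ⊛ count (withCopiesUpTo B G f)) i
    ≡⟨ cong (ℤ._+_ (count G i)) (mono-⊛-cong-mod (count-withCopiesUpTo G 1≤B f) i i<B+1+f) ⟩
  count G i ℤ.+ (mono B ⊛ (count G ⊛ geom B)) i                         ≡⟨ ⊛-geom-unfold 1≤B (count G) i ⟨
  (count G ⊛ geom B) i                                                  ∎
  where
  open ≡-Reasoning
  i<B+1+f : i < B + suc f
  i<B+1+f = ℕₚ.<-≤-trans i<2+f (ℕₚ.+-monoˡ-≤ (suc f) 1≤B)

count-withCopies : ∀ {B} G → 1 ≤ B → count (withCopies B G) ≗ count G ⊛ geom B
count-withCopies G 1≤B m = count-withCopiesUpTo G 1≤B m m (ℕₚ.n<1+n m)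

length-withCopiesUpTo-zero : ∀ {b} G f → length (withCopiesUpTo (suc b) G f 0) ≡ length (G 0)
length-withCopiesUpTo-zero G zero = refl
length-withCopiesUpTo-zero G (suc f) = trans (Listₚ.length-++ (G 0)) (ℕₚ.+-identityʳ _)

withPartsOfSize : ℕ → Family → Family
withPartsOfSize B G m = withCopies B G m ++ withPart (B , true) (withCopies B G) m

count-withPartsOfSize : ∀ {B} G → 1 ≤ B → count (withPartsOfSize B G) ≗ count G ⊛ overpartFactor B
count-withPartsOfSize {B} G 1≤B = begin
  count (withPartsOfSize B G)                       ≈⟨ (λ m → cong +_ (Listₚ.length-++ (withCopies B G m))) ⟩
  count C ⊕ count (withPart (B , true) C)
    ≈⟨ ⊕-cong (≗-sym (⊛-identityˡ (count C))) (count-withPart (B , true) C) ⟩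
  one ⊛ count C ⊕ mono B ⊛ count C                  ≈⟨ ⊛-distribʳ-⊕ one (mono B) (count C) ⟨
  (one ⊕ mono B) ⊛ count C                          ≈⟨ ⊛-cong {f = one ⊕ mono B} ≗-refl (count-withCopies G 1≤B) ⟩
  (one ⊕ mono B) ⊛ (count G ⊛ geom B)
    ≈⟨ solve 3 (λ p c g → p ⊕' (c ⊕' g) ⊜ c ⊕' (p ⊕' g)) ≗-refl (one ⊕ mono B) (count G) (geom B) ⟩
  count G ⊛ overpartFactor B                        ∎
  where
  C = withCopies B G
  open ≗-Reasoning
  open ⊛-Solver using (solve; _⊜_) renaming (_⊕_ to _⊕'_)

length-withPartsOfSize-self : ∀ {b} G →
  length (withPartsOfSize (suc b) G (suc b)) ≡ length (G (suc b)) + length (G 0) + length (G 0)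
length-withPartsOfSize-self {b} G = begin
  length (withPartsOfSize B G B)
    ≡⟨ Listₚ.length-++ (withCopies B G B) ⟩
  length (G B ++ withPart (B , false) (withCopiesUpTo B G b) B) + length (withPart (B , true) (withCopies B G) B)
    ≡⟨ cong₂ _+_ (Listₚ.length-++ (G B)) (length-withPart-self (B , true) (withCopies B G)) ⟩
  length (G B) + length (withPart (B , false) (withCopiesUpTo B G b) B) + length (G 0)
    ≡⟨ cong (λ n → length (G B) + n + length (G 0))
            (trans (length-withPart-self (B , false) (withCopiesUpTo B G b)) (length-withCopiesUpTo-zero G b)) ⟩
  length (G B) + length (G 0) + length (G 0) ∎
  where
  B = suc b
  open ≡-Reasoning

Precedes : Part → List Part → Set
Precedes p xs = Connected Step (just p) (head xs)

precedes-overline-irrelevant : ∀ {B o o′ xs} → Precedes (B , o) xs → Precedes (B , o′) xs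
precedes-overline-irrelevant {xs = []} just-nothing = just-nothing
precedes-overline-irrelevant {xs = _ ∷ _} (just step) = just step

step-≤ : ∀ {p q} → Step p q → size q ≤ size p
step-≤ (inj₁ q<p) = ℕₚ.<⇒≤ q<p
step-≤ (inj₂ (q≡p , _)) = ℕₚ.≤-reflexive q≡p

linked-bounded : ∀ {b p xs} → Linked Step (p ∷ xs) → size p ≤ b → All (λ q → size q ≤ b) (p ∷ xs)
linked-bounded [-] p≤b = p≤b ∷ []
linked-bounded {p = p} {q ∷ _} (step ∷ linked) p≤b =
  p≤b ∷ linked-bounded linked (ℕₚ.≤-trans (step-≤ {p} {q} step) p≤b)

bounded-precedes : ∀ {b o xs} → All (λ q → size q ≤ b) xs → Precedes (suc b , o) xs
bounded-precedes [] = just-nothing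
bounded-precedes (p≤b ∷ _) = just (inj₁ (s≤s p≤b))

module Enumeration (ℓ : ℕ) where

  RegularOverpartition : ℕ → ℕ → List Part → Set
  RegularOverpartition b m xs = IsOverpartitionOf m xs × IsRegular ℓ xs × All (λ p → size p ≤ b) xs

  Enumerates : ℕ → Family → Set
  Enumerates b G = ∀ m xs → xs ∈ G m ⇔ RegularOverpartition b m xs

  weaken : ∀ {b c m xs} → b ≤ c → RegularOverpartition b m xs → RegularOverpartition c m xs
  weaken b≤c (op , reg , bounded) = op , reg , All.map (λ p≤b → ℕₚ.≤-trans p≤b b≤c) bounded

  cons : ∀ {b m B o xs} → 1 ≤ B → ¬ ℓ ∣ B → B ≤ m → B ≤ b → Precedes (B , o) xs →
         RegularOverpartition b (m ∸ B) xs → RegularOverpartition b m ((B , o) ∷ xs)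
  cons {B = B} 1≤B ℓ∤B B≤m B≤b prec ((linked , positive , sum≡) , reg , bounded) =
    (prec ∷′ linked , 1≤B ∷ positive , trans (cong (_+_ B) sum≡) (ℕₚ.m+[n∸m]≡n B≤m)) ,
    ℓ∤B ∷ reg , B≤b ∷ bounded

  uncons : ∀ {b m B o xs} → RegularOverpartition b m ((B , o) ∷ xs) →
           RegularOverpartition b (m ∸ B) xs × B ≤ m × Precedes (B , o) xs
  uncons {B = B} ((linked , _ ∷ positive , sum≡) , _ ∷ reg , _ ∷ bounded) =
    ((Linked.tail linked , positive , trans (sym (ℕₚ.m+n∸m≡n B _)) (cong (_∸ B) sum≡)) , reg , bounded) ,
    subst (B ≤_) sum≡ (ℕₚ.m≤m+n B _) , head′ linked

  module _ {b G} (G-enum : Enumerates b G) where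

    private
      B = suc b
      to-G : ∀ {m xs} → RegularOverpartition b m xs → xs ∈ G m
      to-G = Equivalence.from (G-enum _ _)
      from-G : ∀ {m xs} → xs ∈ G m → RegularOverpartition b m xs
      from-G = Equivalence.to (G-enum _ _)

    enumerates-divisible : ℓ ∣ suc b → Enumerates (suc b) G
    enumerates-divisible ℓ∣B m xs = mk⇔ (weaken (ℕₚ.n≤1+n b) ∘ from-G) (to-G ∘ lower)
      where
      below : ∀ {p} → ¬ ℓ ∣ size p × size p ≤ suc b → size p ≤ b
      below (ℓ∤p , p≤B) with ℕₚ.m≤n⇒m<n∨m≡n p≤B
      ... | inj₁ p<B = ℕₚ.≤-pred p<B
      ... | inj₂ p≡B = ⊥-elim (ℓ∤p (subst (ℓ ∣_) (sym p≡B) ℓ∣B))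
      lower : RegularOverpartition (suc b) m xs → RegularOverpartition b m xs
      lower (op , reg , bounded) = op , reg , All.zipWith (λ {p} → below {p}) (reg , bounded)

    module _ (ℓ∤B : ¬ ℓ ∣ suc b) where

      withCopiesUpTo-sound : ∀ f {m xs} → xs ∈ withCopiesUpTo B G f m →
                             RegularOverpartition B m xs × Precedes (B , false) xs
      withCopiesUpTo-sound zero xs∈ = lift (from-G xs∈)
        where
        lift : ∀ {m xs} → RegularOverpartition b m xs → RegularOverpartition B m xs × Precedes (B , false) xs
        lift r@(_ , _ , bounded) = weaken (ℕₚ.n≤1+n b) r , bounded-precedes bounded
      withCopiesUpTo-sound (suc f) {m} xs∈ with ∈-++⁻ (G m) xs∈
      ... | inj₁ xs∈G = withCopiesUpTo-sound zero xs∈G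
      ... | inj₂ xs∈W with ∈-withPart⁻ (B , false) (withCopiesUpTo B G f) {m} xs∈W
      ...   | ys , refl , B≤m , ys∈ with withCopiesUpTo-sound f ys∈
      ...     | ys-ok , ys-prec =
        cons (s≤s z≤n) ℓ∤B B≤m ℕₚ.≤-refl ys-prec ys-ok , just (inj₂ (refl , refl))

      ∈-withCopiesUpTo-base : ∀ f {m xs} → xs ∈ G m → xs ∈ withCopiesUpTo B G f m
      ∈-withCopiesUpTo-base zero xs∈ = xs∈
      ∈-withCopiesUpTo-base (suc f) xs∈ = ∈-++⁺ˡ xs∈

      withCopiesUpTo-complete : ∀ f {m} xs → m ≤ f → RegularOverpartition B m xs → Precedes (B , false) xs →
                                xs ∈ withCopiesUpTo B G f m
      withCopiesUpTo-complete f [] _ (op , reg , _) _ = ∈-withCopiesUpTo-base f (to-G (op , reg , []))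
      withCopiesUpTo-complete f (p ∷ ys) _ ((linked , rest) , reg , _) (just (inj₁ p<B)) =
        ∈-withCopiesUpTo-base f (to-G ((linked , rest) , reg , linked-bounded linked (ℕₚ.≤-pred p<B)))
      withCopiesUpTo-complete zero (_ ∷ ys) m≤0 r (just (inj₂ (refl , refl))) =
        ⊥-elim (ℕₚ.n≮0 (ℕₚ.≤-trans (proj₁ (proj₂ (uncons r))) m≤0))
      withCopiesUpTo-complete (suc f) {m} (_ ∷ ys) m≤1+f r (just (inj₂ (refl , refl))) with uncons r
      ... | ys-ok , B≤m , ys-prec =
        ∈-++⁺ʳ (G m) (∈-withPart⁺ (B , false) (withCopiesUpTo B G f) B≤m
                                    (withCopiesUpTo-complete f ys m∸B≤f ys-ok ys-prec))
        where
        m∸B≤f : m ∸ B ≤ f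
        m∸B≤f = ℕₚ.≤-trans (ℕₚ.∸-monoˡ-≤ B m≤1+f) (ℕₚ.m∸n≤m f b)

      ∈-withPartsOfSize⁻ : ∀ {m xs} → xs ∈ withPartsOfSize B G m → RegularOverpartition B m xs
      ∈-withPartsOfSize⁻ {m} xs∈ with ∈-++⁻ (withCopies B G m) xs∈
      ... | inj₁ xs∈C = proj₁ (withCopiesUpTo-sound m xs∈C)
      ... | inj₂ xs∈W with ∈-withPart⁻ (B , true) (withCopies B G) {m} xs∈W
      ...   | ys , refl , B≤m , ys∈ with withCopiesUpTo-sound (m ∸ B) ys∈
      ...     | ys-ok , ys-prec =
        cons (s≤s z≤n) ℓ∤B B≤m ℕₚ.≤-refl (precedes-overline-irrelevant ys-prec) ys-ok

      ∈-withPartsOfSize⁺ : ∀ {m} xs → RegularOverpartition B m xs → xs ∈ withPartsOfSize B G m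
      ∈-withPartsOfSize⁺ {m} [] r = ∈-++⁺ˡ (withCopiesUpTo-complete m [] ℕₚ.≤-refl r just-nothing)
      ∈-withPartsOfSize⁺ {m} ((c , o) ∷ ys) r@(_ , _ , c≤B ∷ _) with ℕₚ.m≤n⇒m<n∨m≡n c≤B
      ... | inj₁ c<B = ∈-++⁺ˡ (withCopiesUpTo-complete m _ ℕₚ.≤-refl r (just (inj₁ c<B)))
      ∈-withPartsOfSize⁺ {m} ((c , false) ∷ ys) r | inj₂ refl =
        ∈-++⁺ˡ (withCopiesUpTo-complete m _ ℕₚ.≤-refl r (just (inj₂ (refl , refl))))
      ∈-withPartsOfSize⁺ {m} ((c , true) ∷ ys) r | inj₂ refl with uncons r
      ... | ys-ok , B≤m , ys-prec = ∈-++⁺ʳ (withCopies B G m) (∈-withPart⁺ (B , true) (withCopies B G) B≤m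
              (withCopiesUpTo-complete (m ∸ B) ys ℕₚ.≤-refl ys-ok (precedes-overline-irrelevant ys-prec)))

      withPartsOfSize-enumerates : Enumerates B (withPartsOfSize B G)
      withPartsOfSize-enumerates m xs = mk⇔ ∈-withPartsOfSize⁻ (∈-withPartsOfSize⁺ xs)

      module _ (G-unique : ∀ m → Unique (G m)) where

        withCopiesUpTo-unique : ∀ f m → Unique (withCopiesUpTo B G f m)
        withCopiesUpTo-unique zero m = G-unique m
        withCopiesUpTo-unique (suc f) m =
          Uniqueₚ.++⁺ (G-unique m)
            (withPart-unique (B , false) (withCopiesUpTo B G f) (withCopiesUpTo-unique f) m) disjoint
          where
          disjoint : Disjoint (G m) (withPart (B , false) (withCopiesUpTo B G f) m)
          disjoint (xs∈G , xs∈W) with ∈-withPart⁻ (B , false) (withCopiesUpTo B G f) {m} xs∈W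
          ... | ys , refl , _ with from-G xs∈G
          ...   | _ , _ , B≤b ∷ _ = ℕₚ.1+n≰n B≤b

        withPartsOfSize-unique : ∀ m → Unique (withPartsOfSize B G m)
        withPartsOfSize-unique m =
          Uniqueₚ.++⁺ (withCopiesUpTo-unique m m)
            (withPart-unique (B , true) (withCopies B G) (λ m′ → withCopiesUpTo-unique m′ m′) m) disjoint
          where
          disjoint : Disjoint (withCopies B G m) (withPart (B , true) (withCopies B G) m)
          disjoint (xs∈C , xs∈W) with ∈-withPart⁻ (B , true) (withCopies B G) {m} xs∈W
          ... | ys , refl , _ with proj₂ (withCopiesUpTo-sound m xs∈C)
          ...   | just (inj₁ B<B) = ℕₚ.<-irrefl refl B<B
          ...   | just (inj₂ (_ , ()))

  onlyEmpty : Family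
  onlyEmpty zero = [] ∷ []
  onlyEmpty (suc _) = []

  onlyEmpty-enumerates : Enumerates 0 onlyEmpty
  onlyEmpty-enumerates m xs = mk⇔ (sound m xs) (complete m xs)
    where
    sound : ∀ m xs → xs ∈ onlyEmpty m → RegularOverpartition 0 m xs
    sound zero _ (here refl) = ([] , [] , refl) , [] , []
    complete : ∀ m xs → RegularOverpartition 0 m xs → xs ∈ onlyEmpty m
    complete _ [] ((_ , _ , refl) , _) = here refl
    complete _ (_ ∷ _) ((_ , 1≤c ∷ _ , _) , _ , c≤0 ∷ _) = ⊥-elim (ℕₚ.<⇒≱ 1≤c c≤0)

  regularOverpartitions : ℕ → Family
  regularOverpartitions zero = onlyEmpty
  regularOverpartitions (suc b) with ℓ ∣? suc b
  ... | yes _ = regularOverpartitions b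
  ... | no _ = withPartsOfSize (suc b) (regularOverpartitions b)

  regularOverpartitions-enumerates : ∀ b → Enumerates b (regularOverpartitions b)
  regularOverpartitions-enumerates zero = onlyEmpty-enumerates
  regularOverpartitions-enumerates (suc b) with ℓ ∣? suc b
  ... | yes ℓ∣B = enumerates-divisible (regularOverpartitions-enumerates b) ℓ∣B
  ... | no ℓ∤B = withPartsOfSize-enumerates (regularOverpartitions-enumerates b) ℓ∤B

  regularOverpartitions-unique : ∀ b m → Unique (regularOverpartitions b m)
  regularOverpartitions-unique zero zero = [] ∷ []
  regularOverpartitions-unique zero (suc m) = []
  regularOverpartitions-unique (suc b) with ℓ ∣? suc b
  ... | yes _ = regularOverpartitions-unique b
  ... | no ℓ∤B = withPartsOfSize-unique (regularOverpartitions-enumerates b) ℓ∤B (regularOverpartitions-unique b)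

  count-regularOverpartitions : ∀ b → count (regularOverpartitions b) ≗ prodTo (regularFactor ℓ) b
  count-regularOverpartitions zero zero = refl
  count-regularOverpartitions zero (suc m) = refl
  count-regularOverpartitions (suc b) with ℓ ∣? suc b
  ... | yes _ = ≗-trans (count-regularOverpartitions b) (≗-sym (⊛-identityʳ _))
  ... | no _ = ≗-trans (count-withPartsOfSize (regularOverpartitions b) (s≤s z≤n))
                       (⊛-cong {g = overpartFactor (suc b)} (count-regularOverpartitions b) ≗-refl)

  length-regularOverpartitions-zero : ∀ b → length (regularOverpartitions b 0) ≡ 1
  length-regularOverpartitions-zero zero = refl
  length-regularOverpartitions-zero (suc b) with ℓ ∣? suc b
  ... | yes _ = length-regularOverpartitions-zero b
  ... | no _ = trans (Listₚ.length-++ (regularOverpartitions b 0))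
                     (trans (ℕₚ.+-identityʳ _) (length-regularOverpartitions-zero b))

  regularOverpartitions-divisible : ∀ {b} → ℓ ∣ suc b → regularOverpartitions (suc b) ≡ regularOverpartitions b
  regularOverpartitions-divisible {b} ℓ∣B with ℓ ∣? suc b
  ... | yes _ = refl
  ... | no ℓ∤B = ⊥-elim (ℓ∤B ℓ∣B)

  -- The new overpartitions of b + 1 are b + 1 and its overlined copy.
  length-regularOverpartitions-self : ∀ {b} → ¬ ℓ ∣ suc b →
    length (regularOverpartitions (suc b) (suc b)) ≡ length (regularOverpartitions b (suc b)) + 1 + 1
  length-regularOverpartitions-self {b} ℓ∤B with ℓ ∣? suc b
  ... | yes ℓ∣B = ⊥-elim (ℓ∤B ℓ∣B)
  ... | no _ = trans (length-withPartsOfSize-self (regularOverpartitions b))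
                     (cong (λ z → length (regularOverpartitions b (suc b)) + z + z) (length-regularOverpartitions-zero b))

countIs-none : ∀ {A : Set} {P : A → Set} → (∀ x → ¬ P x) → CountIs P 0
countIs-none ¬P = [] , [] , (λ x → mk⇔ (λ ()) (⊥-elim ∘ ¬P x)) , refl

module _ {ℓ : ℕ} where

  open Enumeration ℓ

  rhoObjects : ℕ → List (List Part)
  rhoObjects b = map ((suc b , false) ∷_) (regularOverpartitions b (suc b))

  rhoObj-zero : ∀ xs → ¬ RhoObj ℓ 0 xs
  rhoObj-zero ((zero , _) ∷ _) (_ , () , _)
  rhoObj-zero ((suc _ , _) ∷ _) (_ , _ , _ , _ , _ , ())

  rhoObj-double : ∀ {n lam o rest} → RhoObj ℓ n ((lam , o) ∷ rest) → 2 * lam ≡ n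
  rhoObj-double {lam = lam} (_ , _ , _ , (_ , _ , sum≡lam) , _ , lam+sum≡n) =
    trans (double lam) (trans (cong (_+_ lam) (sym sum≡lam)) lam+sum≡n)

  rhoObj-odd : ∀ k xs → ¬ RhoObj ℓ (suc (2 * k)) xs
  rhoObj-odd k ((lam , _) ∷ _) obj = ℕₚ.even≢odd lam k (rhoObj-double obj)

  ∈-rhoObjects : ∀ b xs → xs ∈ rhoObjects b ⇔ RhoObj ℓ (2 * suc b) xs
  ∈-rhoObjects b xs = mk⇔ (to xs) (from xs)
    where
    enum : Enumerates b (regularOverpartitions b)
    enum = regularOverpartitions-enumerates b
    to : ∀ xs → xs ∈ rhoObjects b → RhoObj ℓ (2 * suc b) xs
    to xs xs∈ with ∈-map⁻ ((suc b , false) ∷_) xs∈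
    ... | ys , ys∈ , refl with Equivalence.to (enum (suc b) ys) ys∈
    ...   | op@(_ , _ , sum≡) , reg , bounded =
      refl , s≤s z≤n , All.map s≤s bounded , op , reg , trans (cong (_+_ (suc b)) sum≡) (sym (double (suc b)))
    from : ∀ xs → RhoObj ℓ (2 * suc b) xs → xs ∈ rhoObjects b
    from ((lam , _) ∷ rest) obj@(refl , _ , below , op , reg , _)
      with ℕₚ.*-cancelˡ-≡ lam (suc b) 2 (rhoObj-double obj)
    ... | refl = ∈-map⁺ ((suc b , false) ∷_)
                        (Equivalence.from (enum (suc b) rest) (op , reg , All.map ℕₚ.≤-pred below))

  countIs-rhoObj : ∀ b → CountIs (RhoObj ℓ (2 * suc b)) (length (regularOverpartitions b (suc b)))
  countIs-rhoObj b =
    rhoObjects b ,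
    Uniqueₚ.map⁺ Listₚ.∷-injectiveʳ (regularOverpartitions-unique b (suc b)) ,
    ∈-rhoObjects b ,
    Listₚ.length-map ((suc b , false) ∷_) (regularOverpartitions b (suc b))

  module _ (1≤ℓ : 1 ≤ ℓ) where

    undilatedRhs-zero : undilatedRhs ℓ 0 ≡ 0ℤ
    undilatedRhs-zero =
      cong (λ x → 1ℤ ℤ.- + 2 ℤ.* geom 1 0 ℤ.+ + 2 ℤ.* (x ℤ.* geom ℓ 0) ℤ.+ 1ℤ) (mono-≢ (ℕₚ.<⇒≢ 1≤ℓ))

    undilatedRhs-suc : ∀ b → undilatedRhs ℓ (suc b) ≡ + length (regularOverpartitions b (suc b))
    undilatedRhs-suc b = begin
      undilatedRhs ℓ (suc b)
        ≡⟨ cong₂ (λ x y → x ℤ.- + 2 ℤ.* geom 1 (suc b) ℤ.+ + 2 ℤ.* y ℤ.+ 0ℤ) etaQuotient-value geom-value ⟩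
      + L₁ ℤ.- + 2 ℤ.* geom 1 (suc b) ℤ.+ + 2 ℤ.* geom ℓ (suc b) ℤ.+ 0ℤ
        ≡⟨ cong (λ x → + L₁ ℤ.- + 2 ℤ.* x ℤ.+ + 2 ℤ.* geom ℓ (suc b) ℤ.+ 0ℤ) (geom-∣ (1∣ suc b)) ⟩
      + L₁ ℤ.- + 2 ℤ.* 1ℤ ℤ.+ + 2 ℤ.* geom ℓ (suc b) ℤ.+ 0ℤ
        ≡⟨ drop-largest-part (ℓ ∣? suc b) ⟩
      + L₀ ∎
      where
      open ≡-Reasoning
      open +-*-Solver
      L₀ L₁ : ℕ
      L₀ = length (regularOverpartitions b (suc b))
      L₁ = length (regularOverpartitions (suc b) (suc b))
      etaQuotient-value : etaQuotient ℓ (suc b) ≡ + L₁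
      etaQuotient-value =
        trans (etaQuotient≗∏regularFactor 1≤ℓ (suc b)) (sym (count-regularOverpartitions (suc b) (suc b)))
      geom-value : (mono ℓ ⊛ geom ℓ) (suc b) ≡ geom ℓ (suc b)
      geom-value = sym (trans (geom-unfold 1≤ℓ (suc b)) (ℤₚ.+-identityˡ _))
      drop-largest-part : Dec (ℓ ∣ suc b) → + L₁ ℤ.- + 2 ℤ.* 1ℤ ℤ.+ + 2 ℤ.* geom ℓ (suc b) ℤ.+ 0ℤ ≡ + L₀
      drop-largest-part (yes ℓ∣) = trans
        (cong₂ (λ x y → + x ℤ.- + 2 ℤ.* 1ℤ ℤ.+ + 2 ℤ.* y ℤ.+ 0ℤ)
               (cong (λ G → length (G (suc b))) (regularOverpartitions-divisible ℓ∣)) (geom-∣ ℓ∣))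
        (solve 1 (λ x → x :- con (+ 2) :* con 1ℤ :+ con (+ 2) :* con 1ℤ :+ con 0ℤ := x) refl (+ L₀))
      drop-largest-part (no ℓ∤) = trans
        (cong₂ (λ x y → + x ℤ.- + 2 ℤ.* 1ℤ ℤ.+ + 2 ℤ.* y ℤ.+ 0ℤ)
               (length-regularOverpartitions-self ℓ∤) (geom-∤ ℓ∤))
        (solve 1 (λ x → x :+ con (+ 1) :+ con (+ 1) :- con (+ 2) :* con 1ℤ :+ con (+ 2) :* con 0ℤ :+ con 0ℤ := x)
               refl (+ L₀))

theorem1p3 : (ℓ : ℕ) → 1 ≤ ℓ → (n : ℕ) →
    Σ ℕ (λ k → CountIs (RhoObj ℓ n) k × + k ≡ rhs ℓ n)
theorem1p3 ℓ 1≤ℓ n with parity n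
... | odd k = 0 , countIs-none (rhoObj-odd k) ,
  sym (trans (rhs-dilate 1≤ℓ (suc (2 * k))) (dilate-odd (undilatedRhs ℓ) k))
... | even zero = 0 , countIs-none rhoObj-zero ,
  sym (trans (rhs-dilate 1≤ℓ 0) (undilatedRhs-zero 1≤ℓ))
... | even (suc b) = length (Enumeration.regularOverpartitions ℓ b (suc b)) , countIs-rhoObj b ,
  sym (trans (rhs-dilate 1≤ℓ (2 * suc b))
             (trans (dilate-even (undilatedRhs ℓ) (suc b)) (undilatedRhs-suc 1≤ℓ b)))
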